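{- For $n\ge 0$, let $r_n$ be the number of tilings of the $(2\times n)$-board by unit squares and dominoes. Let $c_n$ be the number of tilings by unit squares and dominoes of the region obtained from the $(2\times n)$-board by removing the lower cell of its last column, for $n\ge 1$, with $c_0=0$. Then $r_n=c_{n+1}-c_n$ for all $n\ge 0$.
   Context: The $(2\times n)$-board is the rectangle $[0,n]\times[0,2]$ subdivided into $2n$ unit cells, with $r_0=1$ (the empty tiling). A domino is the union of two cells sharing an edge and may be horizontal or vertical. The region counted by $c_n$ consists of the cells $[i-1,i]\times[0,1]$ for $1\le i\le n-1$ and $[i-1,i]\times[1,2]$ for $1\le i\le n$. For example, $c_1=1$ and $c_2=3$. -}

module Defs where

-- Cell (i , j) with i < n, j < 2 is the unit
-- square [i, i+1] × [j, j+1]  (column i counted from 0, row 0 = lower row).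
--
-- A tiling is encoded by labelling every cell of the board: cells outside
-- the region get label `out`; a cell covered by a unit square gets `sq`;
-- a cell covered by a domino gets the direction (E/W/N/S) of the other
-- cell of that domino.  The tilings of the region are in bijection with
-- the *valid* labellings (see `validCell`).

open import Data.Nat using (ℕ; zero; suc; _+_; _<ᵇ_; _≡ᵇ_)
open import Data.Bool using (Bool; true; false; _∧_; _∨_; not; if_then_else_)
open import Data.List using (List; []; _∷_; length; filter; map; concatMap)
open import Data.Product using (_×_; _,_; proj₁; proj₂)
open import Data.Bool.Properties using (T?)

data Label : Set where
  out sq E W N S : Label

allLabels : List Label
allLabels = out ∷ sq ∷ E ∷ W ∷ N ∷ S ∷ []

_=L_ : Label → Label → Bool
out =L out = true
sq  =L sq  = true
E   =L E   = true
W   =L W   = true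
N   =L N   = true
S   =L S   = true
_   =L _   = false

-- A labelling of the board: a list of columns, each column a pair
-- (label of lower cell , label of upper cell).
Labelling : Set
Labelling = List (Label × Label)

lab : Labelling → ℕ → ℕ → Label
lab []             _       _             = out
lab ((a , b) ∷ cs) zero    zero          = a
lab ((a , b) ∷ cs) zero    (suc zero)    = b
lab ((a , b) ∷ cs) zero    (suc (suc _)) = out
lab (_ ∷ cs)       (suc i) j             = lab cs i j

Region : Set
Region = ℕ → ℕ → Bool

validCell : Region → Labelling → ℕ → ℕ → Bool
validCell R L i j with R i j | lab L i j
... | false | l   = l =L out
... | true  | out = false
... | true  | sq  = true
... | true  | E   = R (suc i) j ∧ (lab L (suc i) j =L W)
... | true  | W   = vW i
  where
  vW : ℕ → Bool
  vW zero    = false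
  vW (suc k) = R k j ∧ (lab L k j =L E)
... | true  | N   = (j ≡ᵇ 0) ∧ R i 1 ∧ (lab L i 1 =L S)
... | true  | S   = (j ≡ᵇ 1) ∧ R i 0 ∧ (lab L i 0 =L N)

allBool : List Bool → Bool
allBool []       = true
allBool (b ∷ bs) = b ∧ allBool bs

upTo : ℕ → List ℕ
upTo zero    = []
upTo (suc n) = upTo n Data.List.++ (n ∷ [])

valid : ℕ → Region → Labelling → Bool
valid n R L = allBool (concatMap (λ i → validCell R L i 0 ∷ validCell R L i 1 ∷ []) (upTo n))

labellings : ℕ → List Labelling
labellings zero    = [] ∷ []
labellings (suc n) =
  concatMap (λ a → concatMap (λ b → map (λ cs → (a , b) ∷ cs) (labellings n)) allLabels) allLabels

numTilings : ℕ → Region → ℕ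
numTilings n R = length (filter (λ L → T? (valid n R L)) (labellings n))

board : ℕ → Region
board n i j = (i <ᵇ n) ∧ (j <ᵇ 2)

boardMinus : ℕ → Region
boardMinus n i j = ((j ≡ᵇ 1) ∧ (i <ᵇ n)) ∨ ((j ≡ᵇ 0) ∧ (suc i <ᵇ n))

r : ℕ → ℕ
r n = numTilings n (board n)

c : ℕ → ℕ
c zero    = 0
c (suc n) = numTilings (suc n) (boardMinus (suc n))

-- Reading a tiling column by column, with two flags recording which cells of the next
-- column are covered by horizontal dominoes from the current one, turns tiling counts
-- into transfer-matrix products.  If T is the matrix of a full column and e∅, eᵤ are the
-- unit vectors of "no inflow" and "inflow into the upper cell", then r m is the
-- e∅-entry of Tᵐ e∅, and c (k + 1) that of Tᵏ (e∅ + eᵤ), because the last column of its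
-- region, a single upper cell, is a square or the east end of a horizontal domino.
-- Now T eᵤ = e∅ + (eᵤ with the rows exchanged) and T commutes with exchanging the
-- rows, so T^(k+1) eᵤ and Tᵏ e∅ + Tᵏ eᵤ have the same e∅-entry; this is
-- c (k + 2) = r (k + 1) + c (k + 1).
module Submission where

open import Defs
open import Data.Bool using (Bool; true; false; _∧_; not; if_then_else_)
open import Data.Bool.Properties using (T?; ∧-identityʳ; ∧-zeroʳ)
open import Data.Bool.Solver using (module ∨-∧-Solver)
open import Data.List using (List; []; _∷_; _++_; length; map; filter; concatMap)
open import Data.List.Properties
  using (length-++; filter-++; map-++; map-cong; concatMap-map; concatMap-cong)
open import Data.List.Relation.Unary.All as All using (All; []; _∷_)
open import Data.List.Relation.Unary.All.Properties using (concat⁺; map⁺)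
open import Data.Nat using (ℕ; zero; suc; _+_; _≡ᵇ_)
open import Data.Nat.GeneralisedArithmetic using (fold)
open import Data.Nat.ListAction using (sum)
open import Data.Nat.Properties using (+-comm)
open import Data.Nat.Tactic.RingSolver using (solve-∀)
open import Data.Product using (_,_)
open import Function using (_∘_; flip)
open import Relation.Binary.PropositionalEquality

count : {A : Set} → (A → Bool) → List A → ℕ
count p = length ∘ filter (T? ∘ p)

count-++ : {A : Set} (p : A → Bool) (xs ys : List A) →
           count p (xs ++ ys) ≡ count p xs + count p ys
count-++ p xs ys =
  trans (cong length (filter-++ (T? ∘ p) xs ys)) (length-++ (filter (T? ∘ p) xs))

count-concatMap : {A B : Set} (p : B → Bool) (f : A → List B) (xs : List A) →
                  count p (concatMap f xs) ≡ sum (map (count p ∘ f) xs)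
count-concatMap p f []       = refl
count-concatMap p f (x ∷ xs) =
  trans (count-++ p (f x) (concatMap f xs)) (cong (count p (f x) +_) (count-concatMap p f xs))

count-map : {A B : Set} (p : B → Bool) (g : A → B) (xs : List A) →
            count p (map g xs) ≡ count (p ∘ g) xs
count-map p g []       = refl
count-map p g (x ∷ xs) with p (g x)
... | true  = cong suc (count-map p g xs)
... | false = count-map p g xs

count-∧ : {A : Set} (b : Bool) (p : A → Bool) (xs : List A) →
          count (λ x → b ∧ p x) xs ≡ (if b then count p xs else 0)
count-∧ true  p xs       = refl
count-∧ false p []       = refl
count-∧ false p (x ∷ xs) = count-∧ false p xs

count-cong : {A : Set} {p q : A → Bool} {xs : List A} →
             All (λ x → p x ≡ q x) xs → count p xs ≡ count q xs
count-cong [] = refl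
count-cong {p = p} {q} {x ∷ _} (px≡qx ∷ eqs) with p x | q x | px≡qx
... | true  | true  | refl = cong suc (count-cong eqs)
... | false | false | refl = count-cong eqs

length-labellings : ∀ n → All (λ L → length L ≡ n) (labellings n)
length-labellings zero    = refl ∷ []
length-labellings (suc n) =
  concat⁺ (map⁺ (All.universal (λ a →
    concat⁺ (map⁺ (All.universal (λ b →
      map⁺ {f = (a , b) ∷_} (All.map (cong suc) (length-labellings n))) allLabels))) allLabels))

shift : Region → Region
shift R i j = R (suc i) j

_⇒ᵇ_ : Bool → Bool → Bool
false ⇒ᵇ _ = true
true  ⇒ᵇ b = b

checkCell : (inRegion : Bool) → Label → (east west north south : Bool) → Bool
checkCell false l   _ _ _ _ = l =L out
checkCell true  out _ _ _ _ = false
checkCell true  sq  _ _ _ _ = true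
checkCell true  E   e _ _ _ = e
checkCell true  W   _ w _ _ = w
checkCell true  N   _ _ n _ = n
checkCell true  S   _ _ _ s = s

-- w₀ and w₁ say whether a domino enters the lower and the upper cell of column 0
-- from the west; validCell is the case w₀ = w₁ = false.
fromWest : Region → (w₀ w₁ : Bool) → Labelling → ℕ → ℕ → Bool
fromWest R w₀ w₁ L zero    zero    = w₀
fromWest R w₀ w₁ L zero    (suc _) = w₁
fromWest R w₀ w₁ L (suc i) j       = R i j ∧ (lab L i j =L E)

validCell′ : Region → (w₀ w₁ : Bool) → Labelling → ℕ → ℕ → Bool
validCell′ R w₀ w₁ L i j =
  checkCell (R i j) (lab L i j)
    (R (suc i) j ∧ (lab L (suc i) j =L W))
    (fromWest R w₀ w₁ L i j)
    ((j ≡ᵇ 0) ∧ R i 1 ∧ (lab L i 1 =L S))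
    ((j ≡ᵇ 1) ∧ R i 0 ∧ (lab L i 0 =L N))

validCell≡validCell′ : ∀ R L i j → validCell R L i j ≡ validCell′ R false false L i j
validCell≡validCell′ R L i j with R i j | lab L i j
... | false | _   = refl
... | true  | out = refl
... | true  | sq  = refl
... | true  | E   = refl
validCell≡validCell′ R L zero    zero    | true | W = refl
validCell≡validCell′ R L zero    (suc j) | true | W = refl
validCell≡validCell′ R L (suc i) j       | true | W = refl
... | true  | N   = refl
... | true  | S   = refl

column′ : Region → (w₀ w₁ : Bool) → Labelling → ℕ → List Bool
column′ R w₀ w₁ L i = validCell′ R w₀ w₁ L i 0 ∷ validCell′ R w₀ w₁ L i 1 ∷ []

valid′ : Region → (w₀ w₁ : Bool) → Labelling → Bool
valid′ R w₀ w₁ L = allBool (concatMap (column′ R w₀ w₁ L) (upTo (length L)))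

valid≡valid′ : ∀ n R L → length L ≡ n → valid n R L ≡ valid′ R false false L
valid≡valid′ _ R L refl = cong allBool (concatMap-cong column≡column′ (upTo (length L)))
  where
  column≡column′ : ∀ i → validCell R L i 0 ∷ validCell R L i 1 ∷ [] ≡ column′ R false false L i
  column≡column′ i =
    cong₂ (λ x y → x ∷ y ∷ []) (validCell≡validCell′ R L i 0) (validCell≡validCell′ R L i 1)

upTo-suc : ∀ n → upTo (suc n) ≡ 0 ∷ map suc (upTo n)
upTo-suc zero    = refl
upTo-suc (suc n) = begin
  upTo (suc n) ++ suc n ∷ []               ≡⟨ cong (_++ suc n ∷ []) (upTo-suc n) ⟩
  0 ∷ map suc (upTo n) ++ map suc (n ∷ []) ≡⟨ cong (0 ∷_) (map-++ suc (upTo n) (n ∷ [])) ⟨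
  0 ∷ map suc (upTo n ++ n ∷ [])           ∎
  where open ≡-Reasoning

column′-shift : ∀ R w₀ w₁ a b cs i →
  column′ R w₀ w₁ ((a , b) ∷ cs) (suc i) ≡
  column′ (shift R) (R 0 0 ∧ (a =L E)) (R 0 1 ∧ (b =L E)) cs i
column′-shift R w₀ w₁ a b cs zero    = refl
column′-shift R w₀ w₁ a b cs (suc i) = refl

valid′-∷ : ∀ R w₀ w₁ a b cs →
  valid′ R w₀ w₁ ((a , b) ∷ cs) ≡
  validCell′ R w₀ w₁ ((a , b) ∷ cs) 0 0 ∧ (validCell′ R w₀ w₁ ((a , b) ∷ cs) 0 1 ∧
  valid′ (shift R) (R 0 0 ∧ (a =L E)) (R 0 1 ∧ (b =L E)) cs)
valid′-∷ R w₀ w₁ a b cs rewrite upTo-suc (length cs) =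
  cong (λ xs → validCell′ R w₀ w₁ L 0 0 ∧ (validCell′ R w₀ w₁ L 0 1 ∧ allBool xs))
    (trans (concatMap-map (column′ R w₀ w₁ L) suc (upTo (length cs)))
           (concatMap-cong (column′-shift R w₀ w₁ a b cs) (upTo (length cs))))
  where
  L : Labelling
  L = (a , b) ∷ cs

checkCell-east : ∀ r l e w n s →
  checkCell r l true w n s ∧ ((r ∧ (l =L E)) ⇒ᵇ e) ≡ checkCell r l e w n s
checkCell-east false l   e w n s = ∧-identityʳ _
checkCell-east true  out e w n s = refl
checkCell-east true  sq  e w n s = refl
checkCell-east true  E   e w n s = refl
checkCell-east true  W   e w n s = ∧-identityʳ w
checkCell-east true  N   e w n s = ∧-identityʳ n
checkCell-east true  S   e w n s = ∧-identityʳ s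

-- A horizontal domino is checked only at its east end (labelled W), against the flag passed on
-- from the previous column; so whether a column is accepted depends only on the
-- column itself and on the two flags.
acceptCell : (inRegion : Bool) → Label → (west north south : Bool) → Bool
acceptCell r l w n s = (w ⇒ᵇ (r ∧ (l =L W))) ∧ checkCell r l true w n s

acceptColumn : (R₀ R₁ w₀ w₁ : Bool) → Label → Label → Bool
acceptColumn R₀ R₁ w₀ w₁ a b =
  acceptCell R₀ a w₀ (R₁ ∧ (b =L S)) false ∧ acceptCell R₁ b w₁ false (R₀ ∧ (a =L N))

accepts : Region → (w₀ w₁ : Bool) → Labelling → Bool
accepts R w₀ w₁ []             = not w₀ ∧ not w₁
accepts R w₀ w₁ ((a , b) ∷ cs) =
  acceptColumn (R 0 0) (R 0 1) w₀ w₁ a b ∧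
  accepts (shift R) (R 0 0 ∧ (a =L E)) (R 0 1 ∧ (b =L E)) cs

inflowMatches : Region → (w₀ w₁ : Bool) → Labelling → Bool
inflowMatches R w₀ w₁ L =
  (w₀ ⇒ᵇ (R 0 0 ∧ (lab L 0 0 =L W))) ∧ (w₁ ⇒ᵇ (R 0 1 ∧ (lab L 0 1 =L W)))

⇒ᵇ-∧-false : ∀ w r → (w ⇒ᵇ (r ∧ false)) ≡ not w
⇒ᵇ-∧-false false r = refl
⇒ᵇ-∧-false true  r = ∧-zeroʳ r

∧-rearrange : ∀ i₀ k₀ i₁ k₁ f₀ f₁ v →
  ((i₀ ∧ k₀) ∧ (i₁ ∧ k₁)) ∧ ((f₀ ∧ f₁) ∧ v) ≡ (i₀ ∧ i₁) ∧ ((k₀ ∧ f₀) ∧ ((k₁ ∧ f₁) ∧ v))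
∧-rearrange = solve 7 (λ i₀ k₀ i₁ k₁ f₀ f₁ v →
    ((i₀ :* k₀) :* (i₁ :* k₁)) :* ((f₀ :* f₁) :* v)
  := (i₀ :* i₁) :* ((k₀ :* f₀) :* ((k₁ :* f₁) :* v))) refl
  where open ∨-∧-Solver

accepts≡inflowMatches∧valid′ : ∀ R w₀ w₁ L →
  accepts R w₀ w₁ L ≡ inflowMatches R w₀ w₁ L ∧ valid′ R w₀ w₁ L
accepts≡inflowMatches∧valid′ R w₀ w₁ [] =
  sym (trans (∧-identityʳ _) (cong₂ _∧_ (⇒ᵇ-∧-false w₀ (R 0 0)) (⇒ᵇ-∧-false w₁ (R 0 1))))
accepts≡inflowMatches∧valid′ R w₀ w₁ ((a , b) ∷ cs) = begin
  ((i₀ ∧ k₀) ∧ (i₁ ∧ k₁)) ∧ accepts R′ w₀′ w₁′ cs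
    ≡⟨ cong (((i₀ ∧ k₀) ∧ (i₁ ∧ k₁)) ∧_) (accepts≡inflowMatches∧valid′ R′ w₀′ w₁′ cs) ⟩
  ((i₀ ∧ k₀) ∧ (i₁ ∧ k₁)) ∧ ((f₀ ∧ f₁) ∧ rest)
    ≡⟨ ∧-rearrange i₀ k₀ i₁ k₁ f₀ f₁ rest ⟩
  (i₀ ∧ i₁) ∧ ((k₀ ∧ f₀) ∧ ((k₁ ∧ f₁) ∧ rest))
    ≡⟨ cong₂ (λ x y → (i₀ ∧ i₁) ∧ (x ∧ (y ∧ rest)))
             (checkCell-east (R 0 0) a e₀ w₀ (R 0 1 ∧ (b =L S)) false)
             (checkCell-east (R 0 1) b e₁ w₁ false (R 0 0 ∧ (a =L N))) ⟩
  (i₀ ∧ i₁) ∧ (validCell′ R w₀ w₁ L 0 0 ∧ (validCell′ R w₀ w₁ L 0 1 ∧ rest))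
    ≡⟨ cong ((i₀ ∧ i₁) ∧_) (valid′-∷ R w₀ w₁ a b cs) ⟨
  inflowMatches R w₀ w₁ L ∧ valid′ R w₀ w₁ L ∎
  where
  open ≡-Reasoning
  L : Labelling
  L = (a , b) ∷ cs
  R′ : Region
  R′ = shift R
  w₀′ w₁′ e₀ e₁ i₀ i₁ k₀ k₁ f₀ f₁ rest : Bool
  w₀′ = R 0 0 ∧ (a =L E)
  w₁′ = R 0 1 ∧ (b =L E)
  e₀ = R 1 0 ∧ (lab cs 0 0 =L W)
  e₁ = R 1 1 ∧ (lab cs 0 1 =L W)
  i₀ = w₀ ⇒ᵇ (R 0 0 ∧ (a =L W))
  i₁ = w₁ ⇒ᵇ (R 0 1 ∧ (b =L W))
  k₀ = checkCell (R 0 0) a true w₀ (R 0 1 ∧ (b =L S)) false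
  k₁ = checkCell (R 0 1) b true w₁ false (R 0 0 ∧ (a =L N))
  f₀ = w₀′ ⇒ᵇ e₀
  f₁ = w₁′ ⇒ᵇ e₁
  rest = valid′ R′ w₀′ w₁′ cs

FlagVec : Set
FlagVec = Bool → Bool → ℕ

numAccepted : Region → ℕ → FlagVec
numAccepted R m w₀ w₁ = count (accepts R w₀ w₁) (labellings m)

numTilings≡numAccepted : ∀ n R → numTilings n R ≡ numAccepted R n false false
numTilings≡numAccepted n R = count-cong (All.map valid≡accepts (length-labellings n))
  where
  valid≡accepts : ∀ {L} → length L ≡ n → valid n R L ≡ accepts R false false L
  valid≡accepts {L} eq =
    trans (valid≡valid′ n R L eq) (sym (accepts≡inflowMatches∧valid′ R false false L))

columnStep : (R₀ R₁ : Bool) → FlagVec → FlagVec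
columnStep R₀ R₁ g w₀ w₁ = sum (map (λ a → sum (map (λ b →
  if acceptColumn R₀ R₁ w₀ w₁ a b then g (R₀ ∧ (a =L E)) (R₁ ∧ (b =L E)) else 0)
  allLabels)) allLabels)

numAccepted-suc : ∀ R m w₀ w₁ →
  numAccepted R (suc m) w₀ w₁ ≡ columnStep (R 0 0) (R 0 1) (numAccepted (shift R) m) w₀ w₁
numAccepted-suc R m w₀ w₁ = begin
  count (accepts R w₀ w₁) (concatMap (λ a → concatMap (withColumn a) allLabels) allLabels)
    ≡⟨ count-concatMap (accepts R w₀ w₁) (λ a → concatMap (withColumn a) allLabels) allLabels ⟩
  sum (map (λ a → count (accepts R w₀ w₁) (concatMap (withColumn a) allLabels)) allLabels)
    ≡⟨ cong sum (map-cong (λ a →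
         count-concatMap (accepts R w₀ w₁) (withColumn a) allLabels) allLabels) ⟩
  sum (map (λ a → sum (map (λ b → count (accepts R w₀ w₁) (withColumn a b)) allLabels)) allLabels)
    ≡⟨ cong sum (map-cong (λ a → cong sum (map-cong (countColumn a) allLabels)) allLabels) ⟩
  columnStep (R 0 0) (R 0 1) (numAccepted (shift R) m) w₀ w₁ ∎
  where
  open ≡-Reasoning
  withColumn : Label → Label → List Labelling
  withColumn a b = map ((a , b) ∷_) (labellings m)
  countColumn : ∀ a b → count (accepts R w₀ w₁) (withColumn a b) ≡
    (if acceptColumn (R 0 0) (R 0 1) w₀ w₁ a b
     then numAccepted (shift R) m (R 0 0 ∧ (a =L E)) (R 0 1 ∧ (b =L E)) else 0)
  countColumn a b = trans (count-map (accepts R w₀ w₁) ((a , b) ∷_) (labellings m))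
    (count-∧ (acceptColumn (R 0 0) (R 0 1) w₀ w₁ a b)
             (accepts (shift R) (R 0 0 ∧ (a =L E)) (R 0 1 ∧ (b =L E))) (labellings m))

-- In a full column a cell with inflow is labelled W; every other cell is a square, is
-- labelled E (producing outflow), or forms a vertical domino with its neighbour.
-- transfer g sums g over the outflows of all these fillings.
transfer : FlagVec → FlagVec
transfer g false false = g false false + g false true + g true false + g true true + g false false
transfer g false true  = g false false + g true false
transfer g true  false = g false false + g false true
transfer g true  true  = g false false

-- The left-hand sides below are the normal forms of columnStep true true g.
columnStep-full : ∀ g w₀ w₁ → columnStep true true g w₀ w₁ ≡ transfer g w₀ w₁
columnStep-full g false false = normalise (g false false) (g false true) (g true false) (g true true)
  where
  normalise : ∀ a b c d → (a + (b + 0)) + ((c + (d + 0)) + ((a + 0) + 0)) ≡ a + b + c + d + a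
  normalise = solve-∀
columnStep-full g false true  = normalise (g false false) (g true false)
  where
  normalise : ∀ a c → (a + 0) + ((c + 0) + 0) ≡ a + c
  normalise = solve-∀
columnStep-full g true  false = normalise (g false false) (g false true)
  where
  normalise : ∀ a b → (a + (b + 0)) + 0 ≡ a + b
  normalise = solve-∀
columnStep-full g true  true  = normalise (g false false)
  where
  normalise : ∀ a → (a + 0) + 0 ≡ a
  normalise = solve-∀

infix  4 _≐_
infixl 6 _⊕_

_≐_ : FlagVec → FlagVec → Set
f ≐ g = ∀ x y → f x y ≡ g x y

_⊕_ : FlagVec → FlagVec → FlagVec
(f ⊕ g) x y = f x y + g x y

transfer-cong : ∀ {f g} → f ≐ g → transfer f ≐ transfer g
transfer-cong f≐g false false
  rewrite f≐g false false | f≐g false true | f≐g true false | f≐g true true = refl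
transfer-cong f≐g false true  rewrite f≐g false false | f≐g true false  = refl
transfer-cong f≐g true  false rewrite f≐g false false | f≐g false true  = refl
transfer-cong f≐g true  true  rewrite f≐g false false = refl

transfer-⊕ : ∀ f g → transfer (f ⊕ g) ≐ transfer f ⊕ transfer g
transfer-⊕ f g false false =
  interchange (f false false) (f false true) (f true false) (f true true)
              (g false false) (g false true) (g true false) (g true true)
  where
  interchange : ∀ a b c d p q r s →
    (a + p) + (b + q) + (c + r) + (d + s) + (a + p) ≡ (a + b + c + d + a) + (p + q + r + s + p)
  interchange = solve-∀
transfer-⊕ f g false true  = interchange (f false false) (f true false) (g false false) (g true false)
  where
  interchange : ∀ a c p r → (a + p) + (c + r) ≡ (a + c) + (p + r)
  interchange = solve-∀
transfer-⊕ f g true  false = interchange (f false false) (f false true) (g false false) (g false true)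
  where
  interchange : ∀ a b p q → (a + p) + (b + q) ≡ (a + b) + (p + q)
  interchange = solve-∀
transfer-⊕ f g true  true  = refl

-- Exchanging the two flags is the reflection of the board in its horizontal axis.
transfer-flip : ∀ g → transfer (flip g) ≐ flip (transfer g)
transfer-flip g false false =
  cong (_+ g false false) (+-middle (g false false) (g true false) (g false true) (g true true))
  where
  +-middle : ∀ a b c d → a + b + c + d ≡ a + c + b + d
  +-middle = solve-∀
transfer-flip g false true  = refl
transfer-flip g true  false = refl
transfer-flip g true  true  = refl

noInflow upperInflow : FlagVec
noInflow false false = 1
noInflow _     _     = 0
upperInflow false true = 1
upperInflow _     _    = 0

numAccepted-board : ∀ m → numAccepted (board m) m ≐ fold noInflow transfer m
numAccepted-board zero    false false = refl
numAccepted-board zero    false true  = refl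
numAccepted-board zero    true  false = refl
numAccepted-board zero    true  true  = refl
numAccepted-board (suc m) w₀ w₁ =
  trans (numAccepted-suc (board (suc m)) m w₀ w₁)
    (trans (columnStep-full (numAccepted (board m) m) w₀ w₁)
           (transfer-cong (numAccepted-board m) w₀ w₁))

numAccepted-boardMinus : ∀ k →
  numAccepted (boardMinus (suc k)) (suc k) ≐ fold noInflow transfer k ⊕ fold upperInflow transfer k
numAccepted-boardMinus zero    false false = refl
numAccepted-boardMinus zero    false true  = refl
numAccepted-boardMinus zero    true  false = refl
numAccepted-boardMinus zero    true  true  = refl
numAccepted-boardMinus (suc k) w₀ w₁ =
  trans (numAccepted-suc (boardMinus (suc (suc k))) (suc k) w₀ w₁)
    (trans (columnStep-full (numAccepted (boardMinus (suc k)) (suc k)) w₀ w₁)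
    (trans (transfer-cong (numAccepted-boardMinus k) w₀ w₁)
           (transfer-⊕ (fold noInflow transfer k) (fold upperInflow transfer k) w₀ w₁)))

fold-upperInflow : ∀ k →
  fold upperInflow transfer (suc k) ≐ fold noInflow transfer k ⊕ flip (fold upperInflow transfer k)
fold-upperInflow zero    false false = refl
fold-upperInflow zero    false true  = refl
fold-upperInflow zero    true  false = refl
fold-upperInflow zero    true  true  = refl
fold-upperInflow (suc k) w₀ w₁ =
  trans (transfer-cong (fold-upperInflow k) w₀ w₁)
    (trans (transfer-⊕ (fold noInflow transfer k) (flip (fold upperInflow transfer k)) w₀ w₁)
           (cong (fold noInflow transfer (suc k) w₀ w₁ +_)
                 (transfer-flip (fold upperInflow transfer k) w₀ w₁)))

r≡fold : ∀ m → r m ≡ fold noInflow transfer m false false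
r≡fold m = trans (numTilings≡numAccepted m (board m)) (numAccepted-board m false false)

c≡fold : ∀ k →
  c (suc k) ≡ fold noInflow transfer k false false + fold upperInflow transfer k false false
c≡fold k =
  trans (numTilings≡numAccepted (suc k) (boardMinus (suc k))) (numAccepted-boardMinus k false false)

lemma2 : (n : ℕ) → c (suc n) ≡ c n + r n
lemma2 zero    = refl
lemma2 (suc k) = begin
  c (suc (suc k))         ≡⟨ c≡fold (suc k) ⟩
  a (suc k) + u (suc k)   ≡⟨ cong (a (suc k) +_) (fold-upperInflow k false false) ⟩
  a (suc k) + (a k + u k) ≡⟨ +-comm (a (suc k)) (a k + u k) ⟩
  (a k + u k) + a (suc k) ≡⟨ cong₂ _+_ (c≡fold k) (r≡fold (suc k)) ⟨
  c (suc k) + r (suc k)   ∎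
  where
  open ≡-Reasoning
  a u : ℕ → ℕ
  a m = fold noInflow transfer m false false
  u m = fold upperInflow transfer m false false
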